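{- Let $\ell\ge1$, $m=2\ell$, and let $\mathcal{W}=\{S_1,\dots,S_n\}$ be a nonempty set of DNA words of length $\ell$, with $\mathcal{W}_{\max}=\max_i\mathrm{FE}(S_i)$, $\mathcal{W}_{\min}=\min_i\mathrm{FE}(S_i)$, and suppose $\mathcal{W}_{\max}-\mathcal{W}_{\min}>3D$. Let $\hat S^1,\dots,\hat S^{4^m}$ be all DNA strings of length $m$ ordered so that $\mathrm{FE}(\hat S^1)\le\cdots\le\mathrm{FE}(\hat S^{4^m})$, let $\Delta=\max_{1\le i<4^m}\{\mathrm{FE}(\hat S^{i+1})-\mathrm{FE}(\hat S^i)\}$, $\alpha=\mathcal{W}_{\max}+\mathrm{FE}(\hat S^1)$ and $\beta=\alpha+\Delta$. Then for each $i$ there exists a DNA string $\hat S$ of length $m$ with $\alpha\le \mathrm{FE}(S_i)+\mathrm{FE}(\hat S)\le\beta$.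
   Context: DNA strings are over $\Pi_D=\{A,C,G,T\}$. Fix a pairwise energy table $\Gamma:\Pi_D\times\Pi_D\to\mathbb{R}$, with $\Gamma_{\max}$ and $\Gamma_{\min}$ its largest and smallest entries and $D=\Gamma_{\max}-\Gamma_{\min}$. The free energy of $X=x_1\cdots x_\ell$ is $\mathrm{FE}(X)=\sum_{i=1}^{\ell-1}\Gamma_{x_i,x_{i+1}}$. -}

module Defs where

open import Level using (0ℓ)
open import Data.Nat using (ℕ; zero; suc)
open import Data.Fin using (Fin; zero; suc; inject₁)
open import Data.Vec using (Vec; []; _∷_)
open import Data.Sum using (_⊎_; inj₁; inj₂)
open import Data.Product using (_×_)
open import Relation.Binary.PropositionalEquality using (_≡_)
open import Relation.Nullary using (¬_)
open import Algebra.Structures using (IsAbelianGroup)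
open import Relation.Binary.Structures using (IsTotalOrder)

data Base : Set where
  A C G T : Base

allBases : Fin 4 → Base
allBases zero = A
allBases (suc zero) = C
allBases (suc (suc zero)) = G
allBases (suc (suc (suc zero))) = T

Word : ℕ → Set
Word n = Vec Base n

-- A totally ordered abelian group (translation-invariant total order).
-- The real numbers (ℝ, +, ≤) are an instance; the theorem is stated for all of them.
record OrderedAbelianGroup : Set₁ where
  infixl 6 _+_ _-_
  infix 4 _≤_ _<_
  field
    R : Set
    _+_ : R → R → R
    0# : R
    -_ : R → R
    _≤_ : R → R → Set
    isAbelianGroup : IsAbelianGroup _≡_ _+_ 0# -_
    isTotalOrder : IsTotalOrder _≡_ _≤_
    +-monoʳ-≤ : ∀ z {x y} → x ≤ y → z + x ≤ z + y

  _-_ : R → R → R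
  x - y = x + (- y)

  _<_ : R → R → Set
  x < y = x ≤ y × ¬ (x ≡ y)

  max : R → R → R
  max x y with IsTotalOrder.total isTotalOrder x y
  ... | inj₁ _ = y
  ... | inj₂ _ = x

  min : R → R → R
  min x y with IsTotalOrder.total isTotalOrder x y
  ... | inj₁ _ = x
  ... | inj₂ _ = y

  maxF : ∀ {n} → (Fin (suc n) → R) → R
  maxF {zero} f = f zero
  maxF {suc n} f = max (f zero) (maxF (λ i → f (suc i)))

  minF : ∀ {n} → (Fin (suc n) → R) → R
  minF {zero} f = f zero
  minF {suc n} f = min (f zero) (minF (λ i → f (suc i)))

  maxGap : ∀ {k} → (Fin (suc (suc k)) → R) → R
  maxGap {zero} f = f (suc zero) - f zero
  maxGap {suc k} f = max (f (suc zero) - f zero) (maxGap (λ i → f (suc i)))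

module _ (G : OrderedAbelianGroup) where
  open OrderedAbelianGroup G

  FE : (Base → Base → R) → ∀ {n} → Word n → R
  FE Γ [] = 0#
  FE Γ (x ∷ []) = 0#
  FE Γ (x ∷ y ∷ xs) = Γ x y + FE Γ (y ∷ xs)

  Γmax : (Base → Base → R) → R
  Γmax Γ = maxF (λ i → maxF (λ j → Γ (allBases i) (allBases j)))

  Γmin : (Base → Base → R) → R
  Γmin Γ = minF (λ i → minF (λ j → Γ (allBases i) (allBases j)))

  Dspread : (Base → Base → R) → R
  Dspread Γ = Γmax Γ - Γmin Γ

-- The target window [α, β] has width Δ, the largest gap in the sorted list of the energies of all
-- strings of length 2ℓ, so some Ŝʲ lands in it as soon as the shifted target α − FE(Sᵢ) lies
-- between the smallest and the largest of these energies. The lower end holds since FE(Sᵢ) ≤ 𝒲max.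
-- For the upper end compare with the doubled words SₘᵢₙSₘᵢₙ and SₘₐₓSₘₐₓ: FE(XX) = 2 FE(X) plus one
-- junction term Γ(last X, first X), so their energies are 2𝒲min + Γ₁ and 2𝒲max + Γ₂, and the
-- spread D ≤ 𝒲max − 𝒲min absorbs the difference of the junction terms.
module Submission where

open import Defs
open import Data.Nat using (ℕ; suc; _*_; _≥_)
open import Data.Fin using (Fin; zero; suc; inject₁; fromℕ)
open import Data.Product using (Σ; ∃; _×_; _,_)
open import Data.Sum using (_⊎_; inj₁; inj₂)
open import Data.Vec using ([]; _∷_; _++_; head; last)
open import Relation.Binary.PropositionalEquality using (_≡_; refl; sym; trans; cong; cong₂; subst)
open import Function.Definitions using (Injective; Bijective; Surjective)
open import Relation.Binary.Bundles using (Poset)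
open import Relation.Binary.Structures using (IsTotalOrder)
open import Algebra.Bundles using (AbelianGroup)
import Algebra.Properties.AbelianGroup as AbelianGroupProperties

module OrderedAbelianGroupProperties (𝔾 : OrderedAbelianGroup) where
  open OrderedAbelianGroup 𝔾
  open IsTotalOrder isTotalOrder using (total) renaming (refl to ≤-refl; trans to ≤-trans)

  abelianGroup : AbelianGroup _ _
  abelianGroup = record { isAbelianGroup = isAbelianGroup }

  poset : Poset _ _ _
  poset = record { isPartialOrder = IsTotalOrder.isPartialOrder isTotalOrder }

  open AbelianGroup abelianGroup using (assoc; comm; identityˡ; identityʳ; inverseˡ; inverseʳ; commutativeMonoid)
  open AbelianGroupProperties abelianGroup using (//-rightDividesˡ)
  open import Algebra.Solver.CommutativeMonoid commutativeMonoid using (solve; _⊜_; _⊕_)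
  open import Relation.Binary.Reasoning.PartialOrder poset

  +-monoˡ-≤ : ∀ z {x y} → x ≤ y → x + z ≤ y + z
  +-monoˡ-≤ z {x} {y} x≤y = subst₂ (comm z x) (comm z y) (+-monoʳ-≤ z x≤y)
    where
    subst₂ : ∀ {a b c d} → a ≡ b → c ≡ d → a ≤ c → b ≤ d
    subst₂ refl refl p = p

  +-mono-≤ : ∀ {x y u v} → x ≤ y → u ≤ v → x + u ≤ y + v
  +-mono-≤ {x} {v = v} x≤y u≤v = ≤-trans (+-monoʳ-≤ x u≤v) (+-monoˡ-≤ v x≤y)

  +-cancelˡ-≤ : ∀ z {x y} → z + x ≤ z + y → x ≤ y
  +-cancelˡ-≤ z {x} {y} le = begin
    x               ≡⟨ sym (cancel x) ⟩
    - z + (z + x)   ≤⟨ +-monoʳ-≤ (- z) le ⟩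
    - z + (z + y)   ≡⟨ cancel y ⟩
    y               ∎
    where
    cancel : ∀ u → - z + (z + u) ≡ u
    cancel u = trans (sym (assoc (- z) z u)) (trans (cong (_+ u) (inverseˡ z)) (identityˡ u))

  x+[[y-x]+z]≡y+z : ∀ x y z → x + ((y - x) + z) ≡ y + z
  x+[[y-x]+z]≡y+z x y z = begin-equality
    x + ((y - x) + z)   ≡⟨ solve 3 (λ x d z → x ⊕ (d ⊕ z) ⊜ (d ⊕ x) ⊕ z) refl x (y - x) z ⟩
    ((y - x) + x) + z   ≡⟨ cong (_+ z) (//-rightDividesˡ x y) ⟩
    y + z               ∎

  x≤y⇒0≤y-x : ∀ {x y} → x ≤ y → 0# ≤ y - x
  x≤y⇒0≤y-x {x} {y} x≤y = subst (_≤ y - x) (inverseʳ x) (+-monoˡ-≤ (- x) x≤y)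

  0≤x⇒y≤x+y : ∀ {x} y → 0# ≤ x → y ≤ x + y
  0≤x⇒y≤x+y y 0≤x = subst (_≤ _ + y) (identityˡ y) (+-monoˡ-≤ y 0≤x)

  -≤-⇒+≤+ : ∀ {x y u v} → x - y ≤ u - v → x + v ≤ u + y
  -≤-⇒+≤+ {x} {y} {u} {v} le = begin
    x + v               ≡⟨ sym (x+[[y-x]+z]≡y+z y x v) ⟩
    y + ((x - y) + v)   ≤⟨ +-monoʳ-≤ y (+-monoˡ-≤ v le) ⟩
    y + ((u - v) + v)   ≡⟨ cong (y +_) (//-rightDividesˡ v u) ⟩
    y + u               ≡⟨ comm y u ⟩
    u + y               ∎

  y-x≤z⇒y≤x+z : ∀ {x y z} → y - x ≤ z → y ≤ x + z
  y-x≤z⇒y≤x+z {x} {y} {z} le = begin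
    y             ≡⟨ sym (//-rightDividesˡ x y) ⟩
    (y - x) + x   ≤⟨ +-monoˡ-≤ x le ⟩
    z + x         ≡⟨ comm z x ⟩
    x + z         ∎

  max-upperˡ : ∀ x y → x ≤ max x y
  max-upperˡ x y with total x y
  ... | inj₁ x≤y = x≤y
  ... | inj₂ _   = ≤-refl

  max-upperʳ : ∀ x y → y ≤ max x y
  max-upperʳ x y with total x y
  ... | inj₁ _   = ≤-refl
  ... | inj₂ y≤x = y≤x

  max-sel : ∀ x y → max x y ≡ x ⊎ max x y ≡ y
  max-sel x y with total x y
  ... | inj₁ _ = inj₂ refl
  ... | inj₂ _ = inj₁ refl

  min-lowerˡ : ∀ x y → min x y ≤ x
  min-lowerˡ x y with total x y
  ... | inj₁ _   = ≤-refl
  ... | inj₂ y≤x = y≤x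

  min-lowerʳ : ∀ x y → min x y ≤ y
  min-lowerʳ x y with total x y
  ... | inj₁ x≤y = x≤y
  ... | inj₂ _   = ≤-refl

  min-sel : ∀ x y → min x y ≡ x ⊎ min x y ≡ y
  min-sel x y with total x y
  ... | inj₁ _ = inj₁ refl
  ... | inj₂ _ = inj₂ refl

  maxF-upper : ∀ {n} (f : Fin (suc n) → R) i → f i ≤ maxF f
  maxF-upper {ℕ.zero} f zero    = ≤-refl
  maxF-upper {suc n}  f zero    = max-upperˡ _ _
  maxF-upper {suc n}  f (suc i) = ≤-trans (maxF-upper (λ j → f (suc j)) i) (max-upperʳ _ _)

  maxF-attained : ∀ {n} (f : Fin (suc n) → R) → ∃ λ i → maxF f ≡ f i
  maxF-attained {ℕ.zero} f = zero , refl
  maxF-attained {suc n}  f with max-sel (f zero) (maxF (λ j → f (suc j)))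
  ... | inj₁ eq = zero , eq
  ... | inj₂ eq = let i , eq′ = maxF-attained (λ j → f (suc j)) in suc i , trans eq eq′

  minF-lower : ∀ {n} (f : Fin (suc n) → R) i → minF f ≤ f i
  minF-lower {ℕ.zero} f zero    = ≤-refl
  minF-lower {suc n}  f zero    = min-lowerˡ _ _
  minF-lower {suc n}  f (suc i) = ≤-trans (min-lowerʳ _ _) (minF-lower (λ j → f (suc j)) i)

  minF-attained : ∀ {n} (f : Fin (suc n) → R) → ∃ λ i → minF f ≡ f i
  minF-attained {ℕ.zero} f = zero , refl
  minF-attained {suc n}  f with min-sel (f zero) (minF (λ j → f (suc j)))
  ... | inj₁ eq = zero , eq
  ... | inj₂ eq = let i , eq′ = minF-attained (λ j → f (suc j)) in suc i , trans eq eq′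

  Sorted : ∀ {n} → (Fin (suc n) → R) → Set
  Sorted g = ∀ j → g (inject₁ j) ≤ g (suc j)

  sorted-first≤ : ∀ {n} {g : Fin (suc n) → R} → Sorted g → ∀ j → g zero ≤ g j
  sorted-first≤         sorted zero    = ≤-refl
  sorted-first≤ {suc n} sorted (suc j) = ≤-trans (sorted zero) (sorted-first≤ (λ i → sorted (suc i)) j)

  sorted-≤last : ∀ {n} {g : Fin (suc n) → R} → Sorted g → ∀ j → g j ≤ g (fromℕ n)
  sorted-≤last {g = g} sorted zero    = sorted-first≤ {g = g} sorted (fromℕ _)
  sorted-≤last {suc n} sorted (suc j) = sorted-≤last (λ i → sorted (suc i)) j

  firstGap≤maxGap : ∀ {k} (g : Fin (suc (suc k)) → R) → g (suc zero) - g zero ≤ maxGap g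
  firstGap≤maxGap {ℕ.zero} g = ≤-refl
  firstGap≤maxGap {suc k}  g = max-upperˡ _ _

  sorted-hits-window : ∀ {k} {g : Fin (suc (suc k)) → R} → Sorted g →
                       ∀ {c} → g zero ≤ c → c ≤ g (fromℕ (suc k)) →
                       ∃ λ j → c ≤ g j × g j ≤ c + maxGap g
  sorted-hits-window {ℕ.zero} {g} sorted first≤c c≤last =
    suc zero , c≤last , ≤-trans (y-x≤z⇒y≤x+z (firstGap≤maxGap g)) (+-monoˡ-≤ _ first≤c)
  sorted-hits-window {suc k} {g} sorted {c} first≤c c≤last with total c (g (suc zero))
  ... | inj₁ c≤second =
    suc zero , c≤second , ≤-trans (y-x≤z⇒y≤x+z (firstGap≤maxGap g)) (+-monoˡ-≤ _ first≤c)
  ... | inj₂ second≤c =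
    let j , c≤gj , gj≤ = sorted-hits-window (λ i → sorted (suc i)) second≤c c≤last
    in suc j , c≤gj , ≤-trans gj≤ (+-monoʳ-≤ c (max-upperʳ _ _))

  sorted-hits-shifted-window : ∀ {k} {g : Fin (suc (suc k)) → R} → Sorted g →
                               ∀ {a b} → a ≤ b → b + g zero ≤ a + g (fromℕ (suc k)) →
                               ∃ λ j → b + g zero ≤ a + g j × a + g j ≤ (b + g zero) + maxGap g
  sorted-hits-shifted-window {k} {g} sorted {a} {b} a≤b reach =
    let j , c≤gj , gj≤c+Δ = sorted-hits-window sorted first≤c c≤last
    in j , subst (_≤ a + g j) a+c≡b+first (+-monoʳ-≤ a c≤gj) , (begin
         a + g j                  ≤⟨ +-monoʳ-≤ a gj≤c+Δ ⟩
         a + (c + maxGap g)       ≡⟨ sym (assoc a c (maxGap g)) ⟩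
         (a + c) + maxGap g       ≡⟨ cong (_+ maxGap g) a+c≡b+first ⟩
         (b + g zero) + maxGap g  ∎)
    where
    c : R
    c = (b - a) + g zero
    a+c≡b+first : a + c ≡ b + g zero
    a+c≡b+first = x+[[y-x]+z]≡y+z a b (g zero)
    first≤c : g zero ≤ c
    first≤c = 0≤x⇒y≤x+y (g zero) (x≤y⇒0≤y-x a≤b)
    c≤last : c ≤ g (fromℕ (suc k))
    c≤last = +-cancelˡ-≤ a (subst (_≤ a + g (fromℕ (suc k))) (sym a+c≡b+first) reach)

module FreeEnergyProperties (𝔾 : OrderedAbelianGroup) (Γ : Base → Base → OrderedAbelianGroup.R 𝔾) where
  open OrderedAbelianGroup 𝔾
  open OrderedAbelianGroupProperties 𝔾
  open IsTotalOrder isTotalOrder using () renaming (trans to ≤-trans)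
  open AbelianGroup abelianGroup using (assoc; identityˡ; commutativeMonoid)
  open import Algebra.Solver.CommutativeMonoid commutativeMonoid using (solve; _⊜_; _⊕_)
  open import Relation.Binary.Reasoning.PartialOrder poset

  baseIndex : Base → Fin 4
  baseIndex A = zero
  baseIndex C = suc zero
  baseIndex G = suc (suc zero)
  baseIndex T = suc (suc (suc zero))

  allBases-baseIndex : ∀ b → allBases (baseIndex b) ≡ b
  allBases-baseIndex A = refl
  allBases-baseIndex C = refl
  allBases-baseIndex G = refl
  allBases-baseIndex T = refl

  Γ≤Γmax : ∀ x y → Γ x y ≤ Γmax 𝔾 Γ
  Γ≤Γmax x y = subst (_≤ Γmax 𝔾 Γ) (cong₂ Γ (allBases-baseIndex x) (allBases-baseIndex y))
    (≤-trans (maxF-upper (λ j → Γ (allBases (baseIndex x)) (allBases j)) (baseIndex y))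
             (maxF-upper (λ i → maxF (λ j → Γ (allBases i) (allBases j))) (baseIndex x)))

  Γmin≤Γ : ∀ x y → Γmin 𝔾 Γ ≤ Γ x y
  Γmin≤Γ x y = subst (Γmin 𝔾 Γ ≤_) (cong₂ Γ (allBases-baseIndex x) (allBases-baseIndex y))
    (≤-trans (minF-lower (λ i → minF (λ j → Γ (allBases i) (allBases j))) (baseIndex x))
             (minF-lower (λ j → Γ (allBases (baseIndex x)) (allBases j)) (baseIndex y)))

  0≤Dspread : 0# ≤ Dspread 𝔾 Γ
  0≤Dspread = x≤y⇒0≤y-x (≤-trans (Γmin≤Γ A A) (Γ≤Γmax A A))

  threeSpreads≤⇒Γmax+y≤x+Γmin : ∀ {x y} → let D = Dspread 𝔾 Γ in
                                D + D + D ≤ x - y → Γmax 𝔾 Γ + y ≤ x + Γmin 𝔾 Γ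
  threeSpreads≤⇒Γmax+y≤x+Γmin le = -≤-⇒+≤+ (≤-trans D≤3D le)
    where
    D = Dspread 𝔾 Γ
    0≤2D : 0# ≤ D + D
    0≤2D = ≤-trans 0≤Dspread (0≤x⇒y≤x+y D 0≤Dspread)
    D≤3D : D ≤ D + D + D
    D≤3D = 0≤x⇒y≤x+y D 0≤2D

  FE-++[] : ∀ {n} (xs : Word n) → FE 𝔾 Γ (xs ++ []) ≡ FE 𝔾 Γ xs
  FE-++[] []           = refl
  FE-++[] (x ∷ [])     = refl
  FE-++[] (x ∷ y ∷ ys) = cong (Γ x y +_) (FE-++[] (y ∷ ys))

  FE-++ : ∀ {n p} (xs : Word (suc n)) (ys : Word (suc p)) →
          FE 𝔾 Γ (xs ++ ys) ≡ FE 𝔾 Γ xs + (Γ (last xs) (head ys) + FE 𝔾 Γ ys)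
  FE-++ (x ∷ [])      (y ∷ ys) = sym (identityˡ _)
  FE-++ (x ∷ x′ ∷ xs) ys       = trans (cong (Γ x x′ +_) (FE-++ (x′ ∷ xs) ys)) (sym (assoc _ _ _))

  doubled : ∀ {n} → Word n → Word (2 * n)
  doubled X = X ++ (X ++ [])

  FE-doubled : ∀ {n} (X : Word (suc n)) → FE 𝔾 Γ (doubled X) ≡ FE 𝔾 Γ X + (Γ (last X) (head X) + FE 𝔾 Γ X)
  FE-doubled X@(x ∷ _) = trans (FE-++ X (X ++ [])) (cong (λ e → FE 𝔾 Γ X + (Γ (last X) x + e)) (FE-++[] X))

  FE-doubled-≤ : ∀ {n} (X : Word (suc n)) → FE 𝔾 Γ (doubled X) ≤ FE 𝔾 Γ X + (Γmax 𝔾 Γ + FE 𝔾 Γ X)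
  FE-doubled-≤ X = begin
    FE 𝔾 Γ (doubled X)                                   ≡⟨ FE-doubled X ⟩
    FE 𝔾 Γ X + (Γ (last X) (head X) + FE 𝔾 Γ X)          ≤⟨ +-monoʳ-≤ _ (+-monoˡ-≤ _ (Γ≤Γmax (last X) (head X))) ⟩
    FE 𝔾 Γ X + (Γmax 𝔾 Γ + FE 𝔾 Γ X)                     ∎

  FE-doubled-≥ : ∀ {n} (X : Word (suc n)) → FE 𝔾 Γ X + (Γmin 𝔾 Γ + FE 𝔾 Γ X) ≤ FE 𝔾 Γ (doubled X)
  FE-doubled-≥ X = begin
    FE 𝔾 Γ X + (Γmin 𝔾 Γ + FE 𝔾 Γ X)                     ≤⟨ +-monoʳ-≤ _ (+-monoˡ-≤ _ (Γmin≤Γ (last X) (head X))) ⟩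
    FE 𝔾 Γ X + (Γ (last X) (head X) + FE 𝔾 Γ X)          ≡⟨ FE-doubled X ⟨
    FE 𝔾 Γ (doubled X)                                   ∎

  enumeration-first≤ : ∀ {k m} (Ŝ : Fin (suc k) → Word m) → Surjective _≡_ _≡_ Ŝ →
                       Sorted (λ j → FE 𝔾 Γ (Ŝ j)) → ∀ X → FE 𝔾 Γ (Ŝ zero) ≤ FE 𝔾 Γ X
  enumeration-first≤ Ŝ onto sorted X =
    let j , hits = onto X
    in subst (λ Y → FE 𝔾 Γ (Ŝ zero) ≤ FE 𝔾 Γ Y) (hits refl) (sorted-first≤ {g = λ j → FE 𝔾 Γ (Ŝ j)} sorted j)

  enumeration-≤last : ∀ {k m} (Ŝ : Fin (suc k) → Word m) → Surjective _≡_ _≡_ Ŝ →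
                      Sorted (λ j → FE 𝔾 Γ (Ŝ j)) → ∀ X → FE 𝔾 Γ X ≤ FE 𝔾 Γ (Ŝ (fromℕ k))
  enumeration-≤last Ŝ onto sorted X =
    let j , hits = onto X
    in subst (λ Y → FE 𝔾 Γ Y ≤ FE 𝔾 Γ (Ŝ (fromℕ _))) (hits refl) (sorted-≤last {g = λ j → FE 𝔾 Γ (Ŝ j)} sorted j)

  shiftedTarget≤last : ∀ {n k ℓ} (S : Fin (suc n) → Word (suc ℓ)) (Ŝ : Fin (suc (suc k)) → Word (2 * suc ℓ)) →
                       Surjective _≡_ _≡_ Ŝ → Sorted (λ j → FE 𝔾 Γ (Ŝ j)) →
                       let W = maxF (λ i → FE 𝔾 Γ (S i))
                           w = minF (λ i → FE 𝔾 Γ (S i))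
                       in Γmax 𝔾 Γ + w ≤ W + Γmin 𝔾 Γ →
                       ∀ i → W + FE 𝔾 Γ (Ŝ zero) ≤ FE 𝔾 Γ (S i) + FE 𝔾 Γ (Ŝ (fromℕ (suc k)))
  shiftedTarget≤last {k = k} S Ŝ onto sorted junctions i = begin
    W + FE 𝔾 Γ (Ŝ zero)    ≤⟨ +-monoʳ-≤ W first≤doubledMin ⟩
    W + (w + (M + w))      ≡⟨ solve 3 (λ W w M → W ⊕ (w ⊕ (M ⊕ w)) ⊜ (M ⊕ w) ⊕ (W ⊕ w)) refl W w M ⟩
    (M + w) + (W + w)      ≤⟨ +-mono-≤ junctions (+-monoʳ-≤ W (minF-lower FS i)) ⟩
    (W + m) + (W + FS i)   ≡⟨ solve 3 (λ W m a → (W ⊕ m) ⊕ (W ⊕ a) ⊜ a ⊕ (W ⊕ (m ⊕ W))) refl W m (FS i) ⟩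
    FS i + (W + (m + W))   ≤⟨ +-monoʳ-≤ (FS i) doubledMax≤last ⟩
    FS i + FE 𝔾 Γ (Ŝ (fromℕ (suc k)))  ∎
    where
    FS : Fin _ → R
    FS i = FE 𝔾 Γ (S i)
    W w M m : R
    W = maxF FS
    w = minF FS
    M = Γmax 𝔾 Γ
    m = Γmin 𝔾 Γ
    first≤doubledMin : FE 𝔾 Γ (Ŝ zero) ≤ w + (M + w)
    first≤doubledMin =
      let imin , w≡ = minF-attained FS
      in ≤-trans (enumeration-first≤ Ŝ onto sorted (doubled (S imin)))
                 (subst (λ v → FE 𝔾 Γ (doubled (S imin)) ≤ v + (M + v)) (sym w≡) (FE-doubled-≤ (S imin)))
    doubledMax≤last : W + (m + W) ≤ FE 𝔾 Γ (Ŝ (fromℕ (suc k)))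
    doubledMax≤last =
      let imax , W≡ = maxF-attained FS
      in ≤-trans (subst (λ v → v + (m + v) ≤ FE 𝔾 Γ (doubled (S imax))) (sym W≡) (FE-doubled-≥ (S imax)))
                 (enumeration-≤last Ŝ onto sorted (doubled (S imax)))

open OrderedAbelianGroupProperties using (maxF-upper; sorted-hits-shifted-window)
open FreeEnergyProperties using (threeSpreads≤⇒Γmax+y≤x+Γmin; shiftedTarget≤last)

lemma3 : (G : OrderedAbelianGroup) → let open OrderedAbelianGroup G in
           (Γ : Base → Base → R) →
           (ℓ : ℕ) → ℓ ≥ 1 →
           (n : ℕ) (S : Fin (suc n) → Word ℓ) → Injective _≡_ _≡_ S →
           let m = 2 * ℓ
               D = Dspread G Γ
               Wmax = maxF (λ i → FE G Γ (S i))
               Wmin = minF (λ i → FE G Γ (S i))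
           in D + D + D < Wmax - Wmin →
           (k : ℕ) (Ŝ : Fin (suc (suc k)) → Word m) → Bijective _≡_ _≡_ Ŝ →
           (∀ (j : Fin (suc k)) → FE G Γ (Ŝ (inject₁ j)) ≤ FE G Γ (Ŝ (suc j))) →
           let Δ = maxGap (λ j → FE G Γ (Ŝ j))
               α = Wmax + FE G Γ (Ŝ zero)
               β = α + Δ
           in (i : Fin (suc n)) →
              Σ (Word m) (λ X → (α ≤ FE G Γ (S i) + FE G Γ X) × (FE G Γ (S i) + FE G Γ X ≤ β))
lemma3 𝔾 Γ (suc ℓ) _ n S _ (threeSpreads≤range , _) k Ŝ (_ , onto) sorted i =
  let j , α≤ , ≤β = sorted-hits-shifted-window 𝔾 sorted (maxF-upper 𝔾 (λ i → FE 𝔾 Γ (S i)) i)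
                      (shiftedTarget≤last 𝔾 Γ S Ŝ onto sorted (threeSpreads≤⇒Γmax+y≤x+Γmin 𝔾 Γ threeSpreads≤range) i)
  in Ŝ j , α≤ , ≤β
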